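{- Let $\Phi$ be an irreducible finite root system with simple roots $\{\alpha_k\}_{k\in I}$, let $i\in I$ be cominuscule, and let $\alpha,\beta\in\Phi^{(i)}$. Write $s_\alpha\beta=\beta+k\alpha$ where $k=-\langle\alpha^\vee,\beta\rangle$. Then $k\in\{0,-1,-2\}$, and (1) if $\alpha$ and $\beta$ are incomparable then $s_\alpha\beta=\beta$; (2) if $\alpha>\beta$ then $s_\alpha\beta$ is one of: (i) $\beta$; (ii) $-\gamma$ with $\gamma\in\Phi^+\setminus\Phi^{(i)}$; (iii) $-\gamma$ with $\gamma>\alpha$.
   Context: For roots, $\alpha\ge\beta$ means $\alpha-\beta$ is a nonnegative integer combination of simple roots. Let $\theta=\sum_k a_k\alpha_k$ be the highest root; $i$ is cominuscule if $a_i=1$. $\Phi^+$ is the set of positive roots and $\Phi^{(i)}=\{\beta\in\Phi^+\mid\beta\ge\alpha_i\}$. $\alpha^\vee$ is the coroot of $\alpha$ and $s_\alpha$ its reflection, $s_\alpha\beta=\beta-\langle\alpha^\vee,\beta\rangle\alpha$. -}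

module Defs where

open import Data.Nat using (ℕ; zero; suc)
open import Data.Integer using (ℤ; _+_; _*_; -_; _-_; _≤_; _<_; 0ℤ; 1ℤ)
open import Data.Fin using (Fin; zero; suc)
open import Data.Vec using (Vec; lookup; zipWith; map; replicate; tabulate)
open import Data.List using (List)
open import Data.List.Membership.Propositional using (_∈_; _∉_)
open import Data.Product using (Σ; ∃; _×_; _,_)
open import Data.Sum using (_⊎_)
open import Data.Bool using (Bool; true; false)
open import Relation.Binary.PropositionalEquality using (_≡_; _≢_)
open import Relation.Nullary using (¬_)

-- Vectors in ℤ^n are coordinates with respect to the simple roots α_0 … α_{n-1}.

∑ : {n : ℕ} → (Fin n → ℤ) → ℤ
∑ {zero}  f = 0ℤ
∑ {suc n} f = f zero + ∑ (λ k → f (suc k))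

form : {n : ℕ} → (Fin n → Fin n → ℤ) → Vec ℤ n → Vec ℤ n → ℤ
form G u v = ∑ (λ a → ∑ (λ b → lookup u a * G a b * lookup v b))

_⊕_ : {n : ℕ} → Vec ℤ n → Vec ℤ n → Vec ℤ n
u ⊕ v = zipWith _+_ u v

_⊖_ : {n : ℕ} → Vec ℤ n → Vec ℤ n → Vec ℤ n
u ⊖ v = zipWith _-_ u v

_·_ : {n : ℕ} → ℤ → Vec ℤ n → Vec ℤ n
c · v = map (c *_) v

neg : {n : ℕ} → Vec ℤ n → Vec ℤ n
neg v = map -_ v

e : {n : ℕ} → Fin n → Vec ℤ n
e {n} k = tabulate (λ j → δ k j)
  where
  δ : {m : ℕ} → Fin m → Fin m → ℤ
  δ zero    zero    = 1ℤ
  δ zero    (suc _) = 0ℤ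
  δ (suc _) zero    = 0ℤ
  δ (suc a) (suc b) = δ a b

Nonneg : {n : ℕ} → Vec ℤ n → Set
Nonneg v = ∀ k → 0ℤ ≤ lookup v k

Nonpos : {n : ℕ} → Vec ℤ n → Set
Nonpos v = ∀ k → lookup v k ≤ 0ℤ

_≥ʳ_ : {n : ℕ} → Vec ℤ n → Vec ℤ n → Set
α ≥ʳ β = Nonneg (α ⊖ β)

_>ʳ_ : {n : ℕ} → Vec ℤ n → Vec ℤ n → Set
α >ʳ β = (α ≥ʳ β) × (α ≢ β)

-- A (reduced, finite) root system with a chosen base {α_k}, written in
-- coordinates with respect to that base, with a W-invariant positive definite
-- (integer-valued, after rescaling) inner product given by its Gram matrix G.
-- "Pairing G α β c" means ⟨α^∨, β⟩ = c, i.e. 2(α,β) = c (α,α).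
Pairing : {n : ℕ} → (Fin n → Fin n → ℤ) → Vec ℤ n → Vec ℤ n → ℤ → Set
Pairing G α β c = (form G α β + form G α β) ≡ c * form G α α

record RootSystem (n : ℕ) : Set where
  field
    Φ        : List (Vec ℤ n)
    G        : Fin n → Fin n → ℤ
    G-sym    : ∀ a b → G a b ≡ G b a
    G-posdef : ∀ v → v ≢ replicate n 0ℤ → 0ℤ < form G v v
    simple∈  : ∀ k → e k ∈ Φ
    zero∉    : replicate n 0ℤ ∉ Φ
    base     : ∀ α → α ∈ Φ → Nonneg α ⊎ Nonpos α
    integral : ∀ α β → α ∈ Φ → β ∈ Φ → ∃ λ c → Pairing G α β c
    reflect  : ∀ α β c → α ∈ Φ → β ∈ Φ → Pairing G α β c → (β ⊖ (c · α)) ∈ Φ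
    reduced  : ∀ α c → α ∈ Φ → (c · α) ∈ Φ → (c ≡ 1ℤ ⊎ c ≡ - 1ℤ)

module _ {n : ℕ} (R : RootSystem n) where
  open RootSystem R

  Irreducible : Set
  Irreducible = ¬ (Σ (Vec ℤ n → Bool) λ f →
                    (∃ λ α → α ∈ Φ × f α ≡ true) ×
                    (∃ λ β → β ∈ Φ × f β ≡ false) ×
                    (∀ α β → α ∈ Φ → β ∈ Φ → f α ≡ true → f β ≡ false → form G α β ≡ 0ℤ))

  Pos : Vec ℤ n → Set
  Pos β = β ∈ Φ × Nonneg β

  IsHighestRoot : Vec ℤ n → Set
  IsHighestRoot θ = θ ∈ Φ × (∀ α → α ∈ Φ → θ ≥ʳ α)

  Cominuscule : Fin n → Set
  Cominuscule i = ∀ θ → IsHighestRoot θ → lookup θ i ≡ 1ℤ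

  Φ⁽_⁾ : Fin n → Vec ℤ n → Set
  Φ⁽ i ⁾ β = Pos β × (β ≥ʳ e i)

{-# OPTIONS --safe #-}
-- Every root lies between -θ and the highest root θ, and θ has αᵢ-coefficient 1, so all roots
-- have αᵢ-coefficient in {-1, 0, 1} and those of Φ⁽ⁱ⁾ have coefficient 1. Hence s_α β = β - cα
-- has coefficient 1 - c, forcing c ∈ {0, 1, 2}. If c ≠ 0 then (α, β) > 0, so α - β is a root or
-- zero and α, β are comparable. For α > β, c = 1 gives s_α β = -(α - β) with α - β ∉ Φ⁽ⁱ⁾, and
-- c = 2 gives s_α β = -(2α - β) with 2α - β > α.
--
-- The highest root is built as a positive root θ of maximal height. It is dominant, and it has
-- full support because every root lives on one connected component of the Dynkin diagram and Φ
-- is irreducible. So θ pairs positively with the dominant root μ of maximal height above any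
-- positive root γ; then θ - μ is a root or zero, and maximality of θ gives θ ≥ μ ≥ γ.
module Submission where

open import Defs
open import Data.Nat using (ℕ; zero; suc; z≤n; s≤s)
open import Data.Integer
  using (ℤ; +_; -[1+_]; _+_; _*_; -_; _-_; _≤_; _<_; 0ℤ; 1ℤ; +≤+; +<+; -≤-; -<+; nonNegative; positive)
open import Data.Integer.Properties
open import Data.Integer.Tactic.RingSolver using (solve-∀)
open import Algebra.Properties.CommutativeSemigroup +-commutativeSemigroup using (interchange)
open import Data.Fin using (Fin; zero; suc)
open import Data.Fin.Properties using (suc-injective; all?; ¬∀⟶∃¬) renaming (_≟_ to _≟ᶠ_)
open import Data.Vec using (Vec; lookup; replicate)
open import Data.Vec.Properties
  using (lookup-zipWith; lookup-map; lookup-replicate; lookup∘tabulate; tabulate∘lookup; tabulate-cong)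
  renaming (≡-dec to ≡-decᵛ)
open import Data.List using (List; filter)
open import Data.List.Membership.Propositional using (_∈_)
open import Data.List.Membership.Propositional.Properties using (∈-filter⁺; ∈-filter⁻)
import Data.List.Relation.Unary.All as All
open import Data.List.Extrema ≤-totalOrder using (argmax; argmax-all; f[xs]≤f[argmax])
open import Data.Product using (∃; _×_; _,_; proj₁; proj₂)
open import Data.Sum using (_⊎_; inj₁; inj₂; [_,_]′) renaming (map to ⊎-map)
open import Data.Bool using (true; false)
open import Data.Empty using (⊥; ⊥-elim)
open import Function using (_∘_; id)
open import Relation.Binary.PropositionalEquality
open import Relation.Nullary using (¬_; Dec; yes; no; does; proof; contradiction)
open import Relation.Nullary.Reflects using (Reflects; invert)
open import Relation.Nullary.Decidable using (¬?; _→-dec_; decidable-stable; toSum; dec-true; dec-false)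
open import Relation.Unary using (Decidable)

0≤i*j : ∀ {i j} → 0ℤ ≤ i → 0ℤ ≤ j → 0ℤ ≤ i * j
0≤i*j {i} {j} 0≤i 0≤j = subst (_≤ i * j) (*-zeroʳ i) (*-monoˡ-≤-nonNeg i {{nonNegative 0≤i}} 0≤j)

0<i*j : ∀ {i j} → 0ℤ < i → 0ℤ < j → 0ℤ < i * j
0<i*j {i} {j} 0<i 0<j = subst (_< i * j) (*-zeroʳ i) (*-monoˡ-<-pos i {{positive 0<i}} 0<j)

i*j≤0 : ∀ {i j} → 0ℤ ≤ i → j ≤ 0ℤ → i * j ≤ 0ℤ
i*j≤0 {i} {j} 0≤i j≤0 = subst (i * j ≤_) (*-zeroʳ i) (*-monoˡ-≤-nonNeg i {{nonNegative 0≤i}} j≤0)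

0<i*j⇒0<j : ∀ {i j} → 0ℤ ≤ i → 0ℤ < i * j → 0ℤ < j
0<i*j⇒0<j {i} {j} 0≤i 0<ij =
  *-cancelˡ-<-nonNeg i {{nonNegative 0≤i}} (subst (_< i * j) (sym (*-zeroʳ i)) 0<ij)

0<i*j⇒0<i : ∀ {i j} → 0ℤ ≤ j → 0ℤ < i * j → 0ℤ < i
0<i*j⇒0<i {i} {j} 0≤j 0<ij = 0<i*j⇒0<j 0≤j (subst (0ℤ <_) (*-comm i j) 0<ij)

0<i*j⇒j≡0 : ∀ {i j} → 0ℤ < i → i * j ≡ 0ℤ → j ≡ 0ℤ
0<i*j⇒j≡0 {i} 0<i ij≡0 = [ (λ i≡0 → contradiction (sym i≡0) (<⇒≢ 0<i)) , (λ j≡0 → j≡0) ]′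
                           (i*j≡0⇒i≡0∨j≡0 i ij≡0)

x+x≡2*x : ∀ x → x + x ≡ + 2 * x
x+x≡2*x = solve-∀

-- c > 0 because a, x > 0, so c ≠ 1 means c ≥ 2.
x+x≡c*a⇒a≤x : ∀ c {a x} → c ≢ 1ℤ → 0ℤ < a → 0ℤ < x → x + x ≡ c * a → a ≤ x
x+x≡c*a⇒a≤x (+ 0) {a} {x} _ _ 0<x x+x≡0 = contradiction x+x≡0 (≢-sym (<⇒≢ (+-mono-< 0<x 0<x)))
x+x≡c*a⇒a≤x (+ 1) c≢1 _ _ _ = contradiction refl c≢1
x+x≡c*a⇒a≤x -[1+ m ] {+ 0}     _ (+<+ ()) _ _
x+x≡c*a⇒a≤x -[1+ m ] {+ suc k} _ _ 0<x x+x≡ca =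
  ⊥-elim (<-asym (+-mono-< 0<x 0<x) (subst (_< 0ℤ) (sym x+x≡ca) -<+))
x+x≡c*a⇒a≤x (+ suc (suc m)) {a} {x} _ 0<a _ x+x≡ca with a ≤? x
... | yes a≤x = a≤x
... | no  a≰x = contradiction a+a≤x+x (<⇒≱ (+-mono-< (≰⇒> a≰x) (≰⇒> a≰x)))
  where
  expand : ∀ m a → (+ 2 + m) * a ≡ a + a + m * a
  expand = solve-∀
  a+a≤x+x : a + a ≤ x + x
  a+a≤x+x = subst (a + a ≤_) (sym (trans x+x≡ca (expand (+ m) a)))
              (i≤i+j (a + a) (+ m * a) {{nonNegative (0≤i*j {+ m} (+≤+ z≤n) (<⇒≤ 0<a))}})

-1≤1-c≤1⇒c∈[0,2] : ∀ c → - 1ℤ ≤ 1ℤ - c → 1ℤ - c ≤ 1ℤ → c ≡ 0ℤ ⊎ c ≡ 1ℤ ⊎ c ≡ + 2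
-1≤1-c≤1⇒c∈[0,2] (+ 0)                 _        _ = inj₁ refl
-1≤1-c≤1⇒c∈[0,2] (+ 1)                 _        _ = inj₂ (inj₁ refl)
-1≤1-c≤1⇒c∈[0,2] (+ 2)                 _        _ = inj₂ (inj₂ refl)
-1≤1-c≤1⇒c∈[0,2] (+ suc (suc (suc m))) (-≤- ()) _
-1≤1-c≤1⇒c∈[0,2] -[1+ m ]              _        (+≤+ (s≤s ()))

∑-cong : ∀ {n} {f g : Fin n → ℤ} → (∀ k → f k ≡ g k) → ∑ f ≡ ∑ g
∑-cong {zero}  f≗g = refl
∑-cong {suc n} f≗g = cong₂ _+_ (f≗g zero) (∑-cong (f≗g ∘ suc))

∑-zero : ∀ {n} {f : Fin n → ℤ} → (∀ k → f k ≡ 0ℤ) → ∑ f ≡ 0ℤ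
∑-zero {zero}  f≗0 = refl
∑-zero {suc n} f≗0 = cong₂ _+_ (f≗0 zero) (∑-zero (f≗0 ∘ suc))

∑-single : ∀ {n} {f : Fin n → ℤ} j → (∀ k → k ≢ j → f k ≡ 0ℤ) → ∑ f ≡ f j
∑-single {suc n} {f} zero f≗0 =
  trans (cong (_+_ (f zero)) (∑-zero (λ k → f≗0 (suc k) λ ()))) (+-identityʳ (f zero))
∑-single {suc n} {f} (suc j) f≗0 =
  trans (cong₂ _+_ (f≗0 zero λ ()) (∑-single j (λ k k≢j → f≗0 (suc k) (k≢j ∘ suc-injective))))
        (+-identityˡ (f (suc j)))

∑-distrib-+ : ∀ {n} (f g : Fin n → ℤ) → ∑ (λ k → f k + g k) ≡ ∑ f + ∑ g
∑-distrib-+ {zero}  f g = refl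
∑-distrib-+ {suc n} f g =
  trans (cong (_+_ (f zero + g zero)) (∑-distrib-+ (f ∘ suc) (g ∘ suc)))
        (interchange (f zero) (g zero) (∑ (f ∘ suc)) (∑ (g ∘ suc)))

∑-neg : ∀ {n} (f : Fin n → ℤ) → ∑ (λ k → - f k) ≡ - ∑ f
∑-neg {zero}  f = refl
∑-neg {suc n} f =
  trans (cong (_+_ (- f zero)) (∑-neg (f ∘ suc))) (sym (neg-distrib-+ (f zero) (∑ (f ∘ suc))))

∑-distrib-minus : ∀ {n} (f g : Fin n → ℤ) → ∑ (λ k → f k - g k) ≡ ∑ f - ∑ g
∑-distrib-minus f g = trans (∑-distrib-+ f (-_ ∘ g)) (cong (_+_ (∑ f)) (∑-neg g))

*-distribˡ-∑ : ∀ {n} c (f : Fin n → ℤ) → ∑ (λ k → c * f k) ≡ c * ∑ f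
*-distribˡ-∑ {zero}  c f = sym (*-zeroʳ c)
*-distribˡ-∑ {suc n} c f =
  trans (cong (_+_ (c * f zero)) (*-distribˡ-∑ c (f ∘ suc))) (sym (*-distribˡ-+ c (f zero) _))

∑-comm : ∀ {m n} (f : Fin m → Fin n → ℤ) → ∑ (λ a → ∑ (f a)) ≡ ∑ (λ b → ∑ (λ a → f a b))
∑-comm {zero} {n} f = sym (∑-zero {n} (λ _ → refl))
∑-comm {suc m} f =
  trans (cong (_+_ (∑ (f zero))) (∑-comm (f ∘ suc))) (sym (∑-distrib-+ (f zero) _))

∑-nonNeg : ∀ {n} {f : Fin n → ℤ} → (∀ k → 0ℤ ≤ f k) → 0ℤ ≤ ∑ f
∑-nonNeg {zero}  _   = ≤-refl
∑-nonNeg {suc n} 0≤f = +-mono-≤ (0≤f zero) (∑-nonNeg (0≤f ∘ suc))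

∑-nonPos : ∀ {n} {f : Fin n → ℤ} → (∀ k → f k ≤ 0ℤ) → ∑ f ≤ 0ℤ
∑-nonPos {zero}  _   = ≤-refl
∑-nonPos {suc n} f≤0 = +-mono-≤ (f≤0 zero) (∑-nonPos (f≤0 ∘ suc))

∑-pos : ∀ {n} {f : Fin n → ℤ} → (∀ k → 0ℤ ≤ f k) → ∀ j → 0ℤ < f j → 0ℤ < ∑ f
∑-pos {suc n} 0≤f zero    0<fj = +-mono-<-≤ 0<fj (∑-nonNeg (0≤f ∘ suc))
∑-pos {suc n} 0≤f (suc j) 0<fj = +-mono-≤-< (0≤f zero) (∑-pos (0≤f ∘ suc) j 0<fj)

∑-pos⇒∃ : ∀ {n} (f : Fin n → ℤ) → 0ℤ < ∑ f → ∃ λ k → 0ℤ < f k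
∑-pos⇒∃ {n} f 0<∑f =
  let k , fk≰0 = ¬∀⟶∃¬ n (λ k → f k ≤ 0ℤ) (λ k → f k ≤? 0ℤ) (λ f≤0 → ≤⇒≯ (∑-nonPos f≤0) 0<∑f)
  in k , ≰⇒> fk≰0

term≤∑ : ∀ {n} {f : Fin n → ℤ} → (∀ k → 0ℤ ≤ f k) → ∀ j → f j ≤ ∑ f
term≤∑ {suc n} {f} 0≤f zero =
  i≤i+j (f zero) (∑ (f ∘ suc)) {{nonNegative (∑-nonNeg (0≤f ∘ suc))}}
term≤∑ {suc n} {f} 0≤f (suc j) =
  ≤-trans (term≤∑ (0≤f ∘ suc) j) (i≤j+i (∑ (f ∘ suc)) (f zero) {{nonNegative (0≤f zero)}})

∑-nonNeg-≤0 : ∀ {n} {f : Fin n → ℤ} → (∀ k → 0ℤ ≤ f k) → ∑ f ≤ 0ℤ → ∀ k → f k ≡ 0ℤ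
∑-nonNeg-≤0 0≤f ∑≤0 k = ≤-antisym (≤-trans (term≤∑ 0≤f k) ∑≤0) (0≤f k)

∑-nonPos-≥0 : ∀ {n} {f : Fin n → ℤ} → (∀ k → f k ≤ 0ℤ) → 0ℤ ≤ ∑ f → ∀ k → f k ≡ 0ℤ
∑-nonPos-≥0 {f = f} f≤0 0≤∑ k =
  neg-injective (∑-nonNeg-≤0 (neg-mono-≤ ∘ f≤0) (subst (_≤ 0ℤ) (sym (∑-neg f)) (neg-mono-≤ 0≤∑)) k)

0⃗ : ∀ {n} → Vec ℤ n
0⃗ {n} = replicate n 0ℤ

lookup-ext : ∀ {n} {u v : Vec ℤ n} → (∀ a → lookup u a ≡ lookup v a) → u ≡ v
lookup-ext {u = u} {v} u≗v =
  trans (sym (tabulate∘lookup u)) (trans (tabulate-cong u≗v) (tabulate∘lookup v))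

lookup-⊕ : ∀ {n} (u v : Vec ℤ n) a → lookup (u ⊕ v) a ≡ lookup u a + lookup v a
lookup-⊕ u v a = lookup-zipWith _+_ a u v

lookup-⊖ : ∀ {n} (u v : Vec ℤ n) a → lookup (u ⊖ v) a ≡ lookup u a - lookup v a
lookup-⊖ u v a = lookup-zipWith _-_ a u v

lookup-· : ∀ {n} c (u : Vec ℤ n) a → lookup (c · u) a ≡ c * lookup u a
lookup-· c u a = lookup-map a (c *_) u

lookup-neg : ∀ {n} (u : Vec ℤ n) a → lookup (neg u) a ≡ - lookup u a
lookup-neg u a = lookup-map a -_ u

lookup-0⃗ : ∀ {n} (a : Fin n) → lookup 0⃗ a ≡ 0ℤ
lookup-0⃗ a = lookup-replicate a 0ℤ

lookup-⊖· : ∀ {n} c (u v : Vec ℤ n) a → lookup (u ⊖ (c · v)) a ≡ lookup u a - c * lookup v a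
lookup-⊖· c u v a = trans (lookup-⊖ u (c · v) a) (cong (_-_ (lookup u a)) (lookup-· c v a))

⊖-self : ∀ {n} (u : Vec ℤ n) → u ⊖ u ≡ 0⃗
⊖-self u = lookup-ext λ a → trans (lookup-⊖ u u a) (trans (+-inverseʳ (lookup u a)) (sym (lookup-0⃗ a)))

⊖≡0⃗⇒≡ : ∀ {n} {u v : Vec ℤ n} → u ⊖ v ≡ 0⃗ → u ≡ v
⊖≡0⃗⇒≡ {u = u} {v} u-v≡0 = lookup-ext λ a →
  i-j≡0⇒i≡j _ _ (trans (sym (lookup-⊖ u v a)) (trans (cong (λ w → lookup w a) u-v≡0) (lookup-0⃗ a)))

neg-involutiveᵛ : ∀ {n} (u : Vec ℤ n) → neg (neg u) ≡ u
neg-involutiveᵛ u = lookup-ext λ a →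
  trans (lookup-neg (neg u) a) (trans (cong -_ (lookup-neg u a)) (neg-involutive (lookup u a)))

lookup-e-≡ : ∀ {n} (j : Fin n) → lookup (e j) j ≡ 1ℤ
lookup-e-≡ zero    = refl
lookup-e-≡ (suc j) = lookup-e-≡ j

lookup-e-≢ : ∀ {n} {j k : Fin n} → j ≢ k → lookup (e j) k ≡ 0ℤ
lookup-e-≢ {j = zero}  {zero}  j≢k = contradiction refl j≢k
lookup-e-≢ {j = zero}  {suc k} _   = lookup∘tabulate _ k
lookup-e-≢ {j = suc j} {zero}  _   = refl
lookup-e-≢ {j = suc j} {suc k} j≢k = lookup-e-≢ (j≢k ∘ cong suc)

e-nonNeg : ∀ {n} (j : Fin n) → Nonneg (e j)
e-nonNeg j k with j ≟ᶠ k
... | yes refl = subst (0ℤ ≤_) (sym (lookup-e-≡ j)) (+≤+ z≤n)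
... | no  j≢k  = subst (0ℤ ≤_) (sym (lookup-e-≢ j≢k)) ≤-refl

∑-*e : ∀ {n} (f : Fin n → ℤ) j → ∑ (λ k → f k * lookup (e j) k) ≡ f j
∑-*e f j =
  trans (∑-single j (λ k k≢j → trans (cong (f k *_) (lookup-e-≢ (≢-sym k≢j))) (*-zeroʳ (f k))))
        (trans (cong (f j *_) (lookup-e-≡ j)) (*-identityʳ (f j)))

ht : ∀ {n} → Vec ℤ n → ℤ
ht v = ∑ (lookup v)

ht-⊕ : ∀ {n} (u v : Vec ℤ n) → ht (u ⊕ v) ≡ ht u + ht v
ht-⊕ u v = trans (∑-cong (lookup-⊕ u v)) (∑-distrib-+ (lookup u) (lookup v))

ht-⊖ : ∀ {n} (u v : Vec ℤ n) → ht (u ⊖ v) ≡ ht u - ht v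
ht-⊖ u v = trans (∑-cong (lookup-⊖ u v)) (∑-distrib-minus (lookup u) (lookup v))

ht-e : ∀ {n} (j : Fin n) → ht (e j) ≡ 1ℤ
ht-e j = trans (∑-single j (λ k k≢j → lookup-e-≢ (≢-sym k≢j))) (lookup-e-≡ j)

nonNeg-ht≤0 : ∀ {n} {v : Vec ℤ n} → Nonneg v → ht v ≤ 0ℤ → v ≡ 0⃗
nonNeg-ht≤0 0≤v ht≤0 = lookup-ext λ a → trans (∑-nonNeg-≤0 0≤v ht≤0 a) (sym (lookup-0⃗ a))

nonPos-ht≥0 : ∀ {n} {v : Vec ℤ n} → Nonpos v → 0ℤ ≤ ht v → v ≡ 0⃗
nonPos-ht≥0 v≤0 0≤ht = lookup-ext λ a → trans (∑-nonPos-≥0 v≤0 0≤ht a) (sym (lookup-0⃗ a))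

≥ʳ⇒≤ : ∀ {n} {u v : Vec ℤ n} → u ≥ʳ v → ∀ a → lookup v a ≤ lookup u a
≥ʳ⇒≤ {u = u} {v} u≥v a = 0≤i-j⇒j≤i (subst (0ℤ ≤_) (lookup-⊖ u v a) (u≥v a))

≤⇒≥ʳ : ∀ {n} {u v : Vec ℤ n} → (∀ a → lookup v a ≤ lookup u a) → u ≥ʳ v
≤⇒≥ʳ {u = u} {v} v≤u a = subst (0ℤ ≤_) (sym (lookup-⊖ u v a)) (i≤j⇒0≤j-i (v≤u a))

≥ʳ-refl : ∀ {n} (v : Vec ℤ n) → v ≥ʳ v
≥ʳ-refl v = ≤⇒≥ʳ {u = v} {v} (λ _ → ≤-refl)

≥ʳ-trans : ∀ {n} {u v w : Vec ℤ n} → u ≥ʳ v → v ≥ʳ w → u ≥ʳ w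
≥ʳ-trans {u = u} {v} {w} u≥v v≥w =
  ≤⇒≥ʳ {u = u} {w} (λ a → ≤-trans (≥ʳ⇒≤ {u = v} {w} v≥w a) (≥ʳ⇒≤ {u = u} {v} u≥v a))

⊕-≥ʳ : ∀ {n} (u : Vec ℤ n) {v} → Nonneg v → (u ⊕ v) ≥ʳ u
⊕-≥ʳ u {v} 0≤v = ≤⇒≥ʳ {u = u ⊕ v} {u} λ a →
  subst (lookup u a ≤_) (sym (lookup-⊕ u v a)) (i≤i+j (lookup u a) (lookup v a) {{nonNegative (0≤v a)}})

nonPos-⊖⇒≥ʳ : ∀ {n} {u v : Vec ℤ n} → Nonpos (u ⊖ v) → v ≥ʳ u
nonPos-⊖⇒≥ʳ {u = u} {v} u-v≤0 = ≤⇒≥ʳ {u = v} {u} λ a → i-j≤0⇒i≤j (subst (_≤ 0ℤ) (lookup-⊖ u v a) (u-v≤0 a))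

≥ʳ-ht-antisym : ∀ {n} {u v : Vec ℤ n} → u ≥ʳ v → ht u ≤ ht v → u ≡ v
≥ʳ-ht-antisym {u = u} {v} u≥v htu≤htv =
  ⊖≡0⃗⇒≡ (nonNeg-ht≤0 u≥v (subst (_≤ 0ℤ) (sym (ht-⊖ u v)) (i≤j⇒i-j≤0 htu≤htv)))

module _ {n : ℕ} (G : Fin n → Fin n → ℤ) where

  private
    term : Vec ℤ n → Vec ℤ n → Fin n → Fin n → ℤ
    term u w a b = lookup u a * G a b * lookup w b

  form-⊖ˡ : ∀ u v w → form G (u ⊖ v) w ≡ form G u w - form G v w
  form-⊖ˡ u v w = begin
      ∑ (λ a → ∑ (term (u ⊖ v) w a))
    ≡⟨ ∑-cong (λ a → trans (∑-cong (split a)) (∑-distrib-minus (term u w a) (term v w a))) ⟩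
      ∑ (λ a → ∑ (term u w a) - ∑ (term v w a))
    ≡⟨ ∑-distrib-minus (λ a → ∑ (term u w a)) (λ a → ∑ (term v w a)) ⟩
      form G u w - form G v w
    ∎
    where
    open ≡-Reasoning
    distrib : ∀ x y g z → (x - y) * g * z ≡ x * g * z - y * g * z
    distrib = solve-∀
    split : ∀ a b → term (u ⊖ v) w a b ≡ term u w a b - term v w a b
    split a b = trans (cong (λ x → x * G a b * lookup w b) (lookup-⊖ u v a))
                      (distrib (lookup u a) (lookup v a) (G a b) (lookup w b))

  form-negˡ : ∀ u w → form G (neg u) w ≡ - form G u w
  form-negˡ u w = begin
      ∑ (λ a → ∑ (term (neg u) w a))
    ≡⟨ ∑-cong (λ a → trans (∑-cong (split a)) (∑-neg (term u w a))) ⟩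
      ∑ (λ a → - ∑ (term u w a))
    ≡⟨ ∑-neg (λ a → ∑ (term u w a)) ⟩
      - form G u w
    ∎
    where
    open ≡-Reasoning
    distrib : ∀ x g z → - x * g * z ≡ - (x * g * z)
    distrib = solve-∀
    split : ∀ a b → term (neg u) w a b ≡ - term u w a b
    split a b = trans (cong (λ x → x * G a b * lookup w b) (lookup-neg u a))
                      (distrib (lookup u a) (G a b) (lookup w b))

  form-e : ∀ u b → form G u (e b) ≡ ∑ (λ a → lookup u a * G a b)
  form-e u b = ∑-cong (λ a → ∑-*e (λ b′ → lookup u a * G a b′) b)

  form-e-e : ∀ a b → form G (e a) (e b) ≡ G a b
  form-e-e a b = trans (form-e (e a) b)
    (trans (∑-cong (λ a′ → *-comm (lookup (e a) a′) (G a′ b))) (∑-*e (λ a′ → G a′ b) a))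

  form-expand : ∀ u v → form G u v ≡ ∑ (λ b → lookup v b * form G u (e b))
  form-expand u v = trans (∑-comm (term u v)) (∑-cong λ b → begin
      ∑ (λ a → lookup u a * G a b * lookup v b)
    ≡⟨ ∑-cong (λ a → *-comm (lookup u a * G a b) (lookup v b)) ⟩
      ∑ (λ a → lookup v b * (lookup u a * G a b))
    ≡⟨ *-distribˡ-∑ (lookup v b) (λ a → lookup u a * G a b) ⟩
      lookup v b * ∑ (λ a → lookup u a * G a b)
    ≡⟨ cong (lookup v b *_) (form-e u b) ⟨
      lookup v b * form G u (e b)
    ∎)
    where open ≡-Reasoning

  module _ (G-sym : ∀ a b → G a b ≡ G b a) where

    form-sym : ∀ u v → form G u v ≡ form G v u
    form-sym u v = trans (∑-comm (term u v)) (∑-cong λ b → ∑-cong λ a →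
      trans (cong (λ g → lookup u a * g * lookup v b) (G-sym a b))
            (rotate (lookup u a) (G b a) (lookup v b)))
      where
      rotate : ∀ x g y → x * g * y ≡ y * g * x
      rotate = solve-∀

    form-⊖ʳ : ∀ u v w → form G w (u ⊖ v) ≡ form G w u - form G w v
    form-⊖ʳ u v w = trans (form-sym w (u ⊖ v))
      (trans (form-⊖ˡ u v w) (cong₂ _-_ (form-sym u w) (form-sym v w)))

    form-negʳ : ∀ u w → form G w (neg u) ≡ - form G w u
    form-negʳ u w = trans (form-sym w (neg u)) (trans (form-negˡ u w) (cong -_ (form-sym u w)))

maximal-element : ∀ {A : Set} {P : A → Set} (h : A → ℤ) → Decidable P → ∀ {x} (xs : List A) →
                  x ∈ xs → P x → ∃ λ m → (m ∈ xs × P m) × (∀ {y} → y ∈ xs → P y → h y ≤ h m)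
maximal-element h P? {x} xs x∈xs Px =
    argmax h x (filter P? xs)
  , argmax-all h (x∈xs , Px) (All.tabulate (∈-filter⁻ P?))
  , λ y∈xs Py → All.lookup (f[xs]≤f[argmax] x (filter P? xs)) (∈-filter⁺ P? y∈xs Py)

Nonneg? : ∀ {n} (v : Vec ℤ n) → Dec (Nonneg v)
Nonneg? v = all? (λ a → 0ℤ ≤? lookup v a)

SupportedIn : ∀ {n} → (Fin n → Set) → Vec ℤ n → Set
SupportedIn P v = ∀ a → ¬ P a → lookup v a ≡ 0ℤ

SupportedIn? : ∀ {n} {P : Fin n → Set} → Decidable P → ∀ v → Dec (SupportedIn P v)
SupportedIn? P? v = all? (λ a → ¬? (P? a) →-dec (lookup v a ≟ 0ℤ))

e-supported : ∀ {n} {P : Fin n → Set} {k} → P k → SupportedIn P (e k)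
e-supported {P = P} Pk a ¬Pa = lookup-e-≢ (λ k≡a → ¬Pa (subst P k≡a Pk))

neg-supported : ∀ {n} {P : Fin n → Set} {v} → SupportedIn P (neg v) → SupportedIn P v
neg-supported {v = v} -v⊆P a ¬Pa = neg-injective (trans (sym (lookup-neg v a)) (-v⊆P a ¬Pa))

module Roots {n : ℕ} (R : RootSystem n) where
  open RootSystem R

  0<form-root : ∀ {γ} → γ ∈ Φ → 0ℤ < form G γ γ
  0<form-root {γ} γ∈Φ = G-posdef γ (λ γ≡0 → zero∉ (subst (_∈ Φ) γ≡0 γ∈Φ))

  mixed-signs : ∀ {γ a b} → γ ∈ Φ → lookup γ a < 0ℤ → 0ℤ < lookup γ b → ⊥
  mixed-signs {γ} {a} {b} γ∈Φ γa<0 0<γb with base γ γ∈Φ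
  ... | inj₁ 0≤γ = <⇒≱ γa<0 (0≤γ a)
  ... | inj₂ γ≤0 = <⇒≱ 0<γb (γ≤0 b)

  nonPos-root-ht<0 : ∀ {γ} → γ ∈ Φ → Nonpos γ → ht γ < 0ℤ
  nonPos-root-ht<0 γ∈Φ γ≤0 = ≰⇒> λ 0≤ht → zero∉ (subst (_∈ Φ) (nonPos-ht≥0 γ≤0 0≤ht) γ∈Φ)

  neg∈Φ : ∀ {γ} → γ ∈ Φ → neg γ ∈ Φ
  neg∈Φ {γ} γ∈Φ = subst (_∈ Φ) (lookup-ext λ a →
      trans (lookup-⊖· (+ 2) γ γ a) (trans (γ-2γ≡-γ (lookup γ a)) (sym (lookup-neg γ a))))
    (reflect γ γ (+ 2) γ∈Φ γ∈Φ (x+x≡2*x (form G γ γ)))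
    where
    γ-2γ≡-γ : ∀ x → x - + 2 * x ≡ - x
    γ-2γ≡-γ = solve-∀

  -- If neither ⟨α^∨,β⟩ nor ⟨β^∨,α⟩ is 1, both are ≥ 2, so (α,α), (β,β) ≤ (α,β) and
  -- (α-β, α-β) ≤ 0.
  ⊖∈Φ : ∀ {α β} → α ∈ Φ → β ∈ Φ → 0ℤ < form G α β → α ≢ β → α ⊖ β ∈ Φ
  ⊖∈Φ {α} {β} α∈Φ β∈Φ 0<αβ α≢β with integral α β α∈Φ β∈Φ | integral β α β∈Φ α∈Φ
  ... | c , αβ≡c | c′ , βα≡c′ with c ≟ 1ℤ | c′ ≟ 1ℤ
  ... | yes refl | _ = subst (_∈ Φ) (lookup-ext λ a → begin
          lookup (neg (β ⊖ (1ℤ · α))) a     ≡⟨ lookup-neg (β ⊖ (1ℤ · α)) a ⟩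
          - lookup (β ⊖ (1ℤ · α)) a         ≡⟨ cong -_ (lookup-⊖· 1ℤ β α a) ⟩
          - (lookup β a - 1ℤ * lookup α a)  ≡⟨ swap (lookup α a) (lookup β a) ⟩
          lookup α a - lookup β a           ≡⟨ lookup-⊖ α β a ⟨
          lookup (α ⊖ β) a                  ∎)
        (neg∈Φ (reflect α β 1ℤ α∈Φ β∈Φ αβ≡c))
    where
    open ≡-Reasoning
    swap : ∀ x y → - (y - 1ℤ * x) ≡ x - y
    swap = solve-∀
  ... | no _ | yes refl = subst (_∈ Φ) (lookup-ext λ a →
          trans (lookup-⊖· 1ℤ α β a) (trans (cong (_-_ (lookup α a)) (*-identityˡ (lookup β a)))
                                              (sym (lookup-⊖ α β a))))
        (reflect β α 1ℤ β∈Φ α∈Φ βα≡c′)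
  ... | no c≢1 | no c′≢1 = contradiction ‖α-β‖²≤0 (<⇒≱ (G-posdef (α ⊖ β) (α≢β ∘ ⊖≡0⃗⇒≡)))
    where
    A = form G α α
    B = form G β β
    X = form G α β
    A≤X : A ≤ X
    A≤X = x+x≡c*a⇒a≤x c c≢1 (0<form-root α∈Φ) 0<αβ αβ≡c
    B≤X : B ≤ X
    B≤X = subst (B ≤_) (form-sym G G-sym β α)
            (x+x≡c*a⇒a≤x c′ c′≢1 (0<form-root β∈Φ) (subst (0ℤ <_) (form-sym G G-sym α β) 0<αβ) βα≡c′)
    ‖α-β‖² : form G (α ⊖ β) (α ⊖ β) ≡ (A - X) - (X - B)
    ‖α-β‖² = trans (form-⊖ˡ G α β (α ⊖ β))
               (cong₂ _-_ (form-⊖ʳ G G-sym α β α)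
                          (trans (form-⊖ʳ G G-sym α β β) (cong (_- B) (form-sym G G-sym β α))))
    ‖α-β‖²≤0 : form G (α ⊖ β) (α ⊖ β) ≤ 0ℤ
    ‖α-β‖²≤0 = subst (_≤ 0ℤ) (sym ‖α-β‖²) (+-mono-≤ (i≤j⇒i-j≤0 A≤X) (neg-mono-≤ (i≤j⇒0≤j-i B≤X)))

  comparable : ∀ {α β} → α ∈ Φ → β ∈ Φ → 0ℤ < form G α β → α ≥ʳ β ⊎ β ≥ʳ α
  comparable {α} {β} α∈Φ β∈Φ 0<αβ with ≡-decᵛ _≟_ α β
  ... | yes refl = inj₁ (≥ʳ-refl α)
  ... | no  α≢β with base (α ⊖ β) (⊖∈Φ α∈Φ β∈Φ 0<αβ α≢β)
  ...   | inj₁ 0≤α-β = inj₁ 0≤α-β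
  ...   | inj₂ α-β≤0 = inj₂ (nonPos-⊖⇒≥ʳ {u = α} {β} α-β≤0)

  simple-obtuse : ∀ {a b} → a ≢ b → G a b ≤ 0ℤ
  simple-obtuse {a} {b} a≢b with G a b ≤? 0ℤ
  ... | yes Gab≤0 = Gab≤0
  ... | no  Gab≰0 =
    ⊥-elim ([ e-incomparable a≢b , e-incomparable (≢-sym a≢b) ]′
      (comparable (simple∈ a) (simple∈ b) (subst (0ℤ <_) (sym (form-e-e G a b)) (≰⇒> Gab≰0))))
    where
    e-incomparable : ∀ {j k} → j ≢ k → ¬ (e j ≥ʳ e k)
    e-incomparable {j} {k} j≢k ej≥ek = <⇒≱ (+<+ (s≤s z≤n))
      (subst₂ _≤_ (lookup-e-≡ k) (lookup-e-≢ j≢k) (≥ʳ⇒≤ {u = e j} {e k} ej≥ek k))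

  Dominant : Vec ℤ n → Set
  Dominant μ = ∀ k → 0ℤ ≤ form G μ (e k)

  dominant-if-maximal : ∀ {μ} → μ ∈ Φ → Nonneg μ →
                        (∀ k → μ ⊕ e k ∈ Φ → ht (μ ⊕ e k) ≤ ht μ) → Dominant μ
  dominant-if-maximal {μ} μ∈Φ 0≤μ maximal k with 0ℤ ≤? form G μ (e k)
  ... | yes 0≤μαₖ = 0≤μαₖ
  ... | no  μαₖ≱0 = contradiction (maximal k μ+αₖ∈Φ) (<⇒≱ ht<)
    where
    0<⟨μ,-αₖ⟩ : 0ℤ < form G μ (neg (e k))
    0<⟨μ,-αₖ⟩ = subst (0ℤ <_) (sym (form-negʳ G G-sym (e k) μ)) (neg-mono-< (≰⇒> μαₖ≱0))
    μ≢-αₖ : μ ≢ neg (e k)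
    μ≢-αₖ μ≡-αₖ = <⇒≱ (subst (_< 0ℤ) (sym (trans (cong (λ v → lookup v k) μ≡-αₖ)
                     (trans (lookup-neg (e k) k) (cong -_ (lookup-e-≡ k))))) -<+) (0≤μ k)
    μ⊖-αₖ≡μ⊕αₖ : μ ⊖ neg (e k) ≡ μ ⊕ e k
    μ⊖-αₖ≡μ⊕αₖ = lookup-ext λ a →
      trans (lookup-⊖ μ (neg (e k)) a)
        (trans (cong (_-_ (lookup μ a)) (lookup-neg (e k) a))
          (trans (cong (_+_ (lookup μ a)) (neg-involutive (lookup (e k) a))) (sym (lookup-⊕ μ (e k) a))))
    μ+αₖ∈Φ : μ ⊕ e k ∈ Φ
    μ+αₖ∈Φ = subst (_∈ Φ) μ⊖-αₖ≡μ⊕αₖ (⊖∈Φ μ∈Φ (neg∈Φ (simple∈ k)) 0<⟨μ,-αₖ⟩ μ≢-αₖ)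
    ht< : ht μ < ht (μ ⊕ e k)
    ht< = subst (ht μ <_) (sym (trans (ht-⊕ μ (e k)) (cong (_+_ (ht μ)) (ht-e k))))
                (subst (_< ht μ + 1ℤ) (+-identityʳ (ht μ)) (+-monoʳ-< (ht μ) (+<+ (s≤s z≤n))))

  maximal-above-dominant : ∀ {γ μ} → Nonneg γ → μ ∈ Φ → μ ≥ʳ γ →
                           (∀ {y} → y ∈ Φ → y ≥ʳ γ → ht y ≤ ht μ) → Nonneg μ × Dominant μ
  maximal-above-dominant {γ} {μ} 0≤γ μ∈Φ μ≥γ μ-maximal =
    0≤μ , dominant-if-maximal μ∈Φ 0≤μ λ k μ+αₖ∈Φ →
            μ-maximal μ+αₖ∈Φ (≥ʳ-trans {u = μ ⊕ e k} {μ} {γ} (⊕-≥ʳ μ (e-nonNeg k)) μ≥γ)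
    where
    0≤μ : Nonneg μ
    0≤μ a = ≤-trans (0≤γ a) (≥ʳ⇒≤ {u = μ} {γ} μ≥γ a)

  positive-simple-pairing : ∀ {μ} → μ ∈ Φ → Nonneg μ →
                            ∃ λ k → 0ℤ < lookup μ k × 0ℤ < form G μ (e k)
  positive-simple-pairing {μ} μ∈Φ 0≤μ =
    let k , 0<term = ∑-pos⇒∃ _ (subst (0ℤ <_) (form-expand G μ μ) (0<form-root μ∈Φ))
        0<μαₖ = 0<i*j⇒0<j (0≤μ k) 0<term
    in k , 0<i*j⇒0<i (<⇒≤ 0<μαₖ) 0<term , 0<μαₖ

  0<form-dominant : ∀ {ν μ} → (∀ k → 0ℤ < lookup ν k) → μ ∈ Φ → Nonneg μ → Dominant μ →
                    0ℤ < form G ν μ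
  0<form-dominant {ν} {μ} 0<ν μ∈Φ 0≤μ μ-dominant =
    let k , _ , 0<μαₖ = positive-simple-pairing μ∈Φ 0≤μ
    in subst (0ℤ <_) (sym (trans (form-sym G G-sym ν μ) (form-expand G μ ν)))
         (∑-pos (λ b → 0≤i*j (<⇒≤ (0<ν b)) (μ-dominant b)) k (0<i*j (0<ν k) 0<μαₖ))

  Separates : (Fin n → Set) → Set
  Separates P = ∀ a b → P a → ¬ P b → G a b ≡ 0ℤ

  separates-¬ : ∀ {P} → Decidable P → Separates P → Separates (¬_ ∘ P)
  separates-¬ P? P⊥ a b ¬Pa ¬¬Pb = trans (G-sym a b) (P⊥ b a (decidable-stable (P? b) ¬¬Pb) ¬Pa)

  form-separated : ∀ {P u v} → Decidable P → Separates P →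
                   SupportedIn P u → SupportedIn (¬_ ∘ P) v → form G u v ≡ 0ℤ
  form-separated {P} {u} {v} P? P⊥ u⊆P v⊆¬P = ∑-zero λ a → ∑-zero λ b → term≡0 a b
    where
    term≡0 : ∀ a b → lookup u a * G a b * lookup v b ≡ 0ℤ
    term≡0 a b with P? a | P? b
    ... | no ¬Pa | _      = cong (λ x → x * G a b * lookup v b) (u⊆P a ¬Pa)
    ... | yes _  | yes Pb = trans (cong (lookup u a * G a b *_) (v⊆¬P b (λ ¬Pb → ¬Pb Pb)))
                                  (*-zeroʳ (lookup u a * G a b))
    ... | yes Pa | no ¬Pb = trans (cong (λ g → lookup u a * g * lookup v b) (P⊥ a b Pa ¬Pb))
                                  (cong (_* lookup v b) (*-zeroʳ (lookup u a)))

  -- (γ, αₖ) = (δ, αₖ) + (αₖ, αₖ) = (αₖ, αₖ), so γ - 2αₖ = δ - αₖ would be a root with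
  -- coefficient -1 at k and the positive coefficients of δ elsewhere.
  no-step-out-of-support : ∀ {Q γ k} → Decidable Q → Separates Q → γ ∈ Φ →
                           let δ = γ ⊖ e k in δ ∈ Φ → Nonneg δ → SupportedIn Q δ → ¬ Q k → ⊥
  no-step-out-of-support {Q} {γ} {k} Q? Q⊥ γ∈Φ δ∈Φ 0≤δ δ⊆Q ¬Qk
    with positive-simple-pairing δ∈Φ 0≤δ
  ... | a , 0<δₐ , _ = mixed-signs ρ∈Φ ρₖ<0 0<ρₐ
    where
    open ≡-Reasoning
    δ = γ ⊖ e k
    δₖ≡0 : lookup δ k ≡ 0ℤ
    δₖ≡0 = δ⊆Q k ¬Qk
    δ⊥αₖ : form G δ (e k) ≡ 0ℤ
    δ⊥αₖ = trans (form-e G δ k) (∑-zero term≡0)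
      where
      term≡0 : ∀ b → lookup δ b * G b k ≡ 0ℤ
      term≡0 b with Q? b
      ... | yes Qb = trans (cong (lookup δ b *_) (Q⊥ b k Qb ¬Qk)) (*-zeroʳ (lookup δ b))
      ... | no ¬Qb = cong (_* G b k) (δ⊆Q b ¬Qb)
    ⟨αₖ,γ⟩≡⟨αₖ,αₖ⟩ : form G (e k) γ ≡ form G (e k) (e k)
    ⟨αₖ,γ⟩≡⟨αₖ,αₖ⟩ = trans (form-sym G G-sym (e k) γ)
                       (i-j≡0⇒i≡j _ _ (trans (sym (form-⊖ˡ G γ (e k) (e k))) δ⊥αₖ))
    ρ = γ ⊖ ((+ 2) · e k)
    ρ∈Φ : ρ ∈ Φ
    ρ∈Φ = reflect (e k) γ (+ 2) (simple∈ k) γ∈Φ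
            (trans (x+x≡2*x _) (cong (+ 2 *_) ⟨αₖ,γ⟩≡⟨αₖ,αₖ⟩))
    regroup : ∀ g x → g - + 2 * x ≡ (g - x) - x
    regroup = solve-∀
    lookup-ρ : ∀ b → lookup ρ b ≡ lookup δ b - lookup (e k) b
    lookup-ρ b = begin
      lookup ρ b                                   ≡⟨ lookup-⊖· (+ 2) γ (e k) b ⟩
      lookup γ b - + 2 * lookup (e k) b            ≡⟨ regroup (lookup γ b) (lookup (e k) b) ⟩
      lookup γ b - lookup (e k) b - lookup (e k) b ≡⟨ cong (_- lookup (e k) b) (lookup-⊖ γ (e k) b) ⟨
      lookup δ b - lookup (e k) b                  ∎
    ρₖ<0 : lookup ρ k < 0ℤ
    ρₖ<0 = subst (_< 0ℤ) (sym (trans (lookup-ρ k) (cong₂ _-_ δₖ≡0 (lookup-e-≡ k)))) -<+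
    k≢a : k ≢ a
    k≢a k≡a = <⇒≢ 0<δₐ (sym (subst (λ j → lookup δ j ≡ 0ℤ) k≡a δₖ≡0))
    0<ρₐ : 0ℤ < lookup ρ a
    0<ρₐ = subst (0ℤ <_) (sym (trans (lookup-ρ a)
             (trans (cong (_-_ (lookup δ a)) (lookup-e-≢ k≢a)) (+-identityʳ (lookup δ a))))) 0<δₐ

  support-grows : ∀ {Q γ k} → Decidable Q → Separates Q → γ ∈ Φ →
                  let δ = γ ⊖ e k in δ ∈ Φ → Nonneg δ → SupportedIn Q δ → SupportedIn Q γ
  support-grows {Q} {γ} {k} Q? Q⊥ γ∈Φ δ∈Φ 0≤δ δ⊆Q with Q? k
  ... | no ¬Qk = ⊥-elim (no-step-out-of-support Q? Q⊥ γ∈Φ δ∈Φ 0≤δ δ⊆Q ¬Qk)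
  ... | yes Qk = λ a ¬Qa → i-j≡0⇒i≡j _ _ (begin
        lookup γ a - 0ℤ             ≡⟨ cong (_-_ (lookup γ a)) (e-supported {P = Q} {k} Qk a ¬Qa) ⟨
        lookup γ a - lookup (e k) a ≡⟨ lookup-⊖ γ (e k) a ⟨
        lookup (γ ⊖ e k) a          ≡⟨ δ⊆Q a ¬Qa ⟩
        0ℤ                          ∎)
    where open ≡-Reasoning

  module _ {P : Fin n → Set} (P? : Decidable P) (P⊥ : Separates P) where

    positive-root-in-component : ∀ m {γ} → γ ∈ Φ → Nonneg γ → ht γ ≡ + m →
                                 SupportedIn P γ ⊎ SupportedIn (¬_ ∘ P) γ
    positive-root-in-component zero γ∈Φ 0≤γ ht≡0 =
      ⊥-elim (zero∉ (subst (_∈ Φ) (nonNeg-ht≤0 0≤γ (≤-reflexive ht≡0)) γ∈Φ))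
    positive-root-in-component (suc m) {γ} γ∈Φ 0≤γ ht≡1+m
      with positive-simple-pairing γ∈Φ 0≤γ
    ... | k , _ , 0<γαₖ with ≡-decᵛ _≟_ γ (e k)
    ...   | yes refl = [ inj₁ ∘ e-supported {P = P} {k} , inj₂ ∘ e-supported {P = ¬_ ∘ P} {k} ]′ (toSum (P? k))
    ...   | no  γ≢αₖ =
      ⊎-map (support-grows {k = k} P? P⊥ γ∈Φ δ∈Φ 0≤δ)
            (support-grows {k = k} (¬? ∘ P?) (separates-¬ P? P⊥) γ∈Φ δ∈Φ 0≤δ)
            (positive-root-in-component m δ∈Φ 0≤δ htδ)
      where
      δ = γ ⊖ e k
      δ∈Φ : δ ∈ Φ
      δ∈Φ = ⊖∈Φ γ∈Φ (simple∈ k) 0<γαₖ γ≢αₖ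
      htδ : ht δ ≡ + m
      htδ = trans (ht-⊖ γ (e k)) (cong₂ _-_ ht≡1+m (ht-e k))
      0≤δ : Nonneg δ
      0≤δ with base δ δ∈Φ
      ... | inj₁ 0≤δ = 0≤δ
      ... | inj₂ δ≤0 = contradiction (subst (0ℤ ≤_) (sym htδ) (+≤+ z≤n)) (<⇒≱ (nonPos-root-ht<0 δ∈Φ δ≤0))

    root-in-component : ∀ {γ} → γ ∈ Φ → SupportedIn P γ ⊎ SupportedIn (¬_ ∘ P) γ
    root-in-component {γ} γ∈Φ with base γ γ∈Φ
    ... | inj₁ 0≤γ = positive-root-in-component _ γ∈Φ 0≤γ (sym (0≤i⇒+∣i∣≡i (∑-nonNeg 0≤γ)))
    ... | inj₂ γ≤0 = ⊎-map (neg-supported {v = γ}) (neg-supported {v = γ})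
                       (positive-root-in-component _ (neg∈Φ γ∈Φ) 0≤-γ (sym (0≤i⇒+∣i∣≡i (∑-nonNeg 0≤-γ))))
      where
      0≤-γ : Nonneg (neg γ)
      0≤-γ a = subst (0ℤ ≤_) (sym (lookup-neg γ a)) (neg-mono-≤ (γ≤0 a))

module HighestRoot {n : ℕ} (R : RootSystem n) (irr : Irreducible R) (i : Fin n) where
  open RootSystem R
  open Roots R

  private
    maximal-positive = maximal-element ht Nonneg? Φ (simple∈ i) (e-nonNeg i)

  θ : Vec ℤ n
  θ = proj₁ maximal-positive

  θ∈Φ : θ ∈ Φ
  θ∈Φ = proj₁ (proj₁ (proj₂ maximal-positive))

  θ-nonNeg : Nonneg θ
  θ-nonNeg = proj₂ (proj₁ (proj₂ maximal-positive))

  θ-maximal : ∀ {γ} → γ ∈ Φ → Nonneg γ → ht γ ≤ ht θ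
  θ-maximal = proj₂ (proj₂ maximal-positive)

  θ-dominant : Dominant θ
  θ-dominant = dominant-if-maximal θ∈Φ θ-nonNeg λ k θ+αₖ∈Φ →
    θ-maximal θ+αₖ∈Φ (λ a → ≤-trans (θ-nonNeg a) (≥ʳ⇒≤ {u = θ ⊕ e k} {θ} (⊕-≥ʳ θ (e-nonNeg k)) a))

  θ-separates : Separates (λ a → 0ℤ < lookup θ a)
  θ-separates a b 0<θₐ θb≯0 =
    0<i*j⇒j≡0 0<θₐ (∑-nonPos-≥0 term≤0 (subst (0ℤ ≤_) (form-e G θ b) (θ-dominant b)) a)
    where
    term≤0 : ∀ a′ → lookup θ a′ * G a′ b ≤ 0ℤ
    term≤0 a′ with a′ ≟ᶠ b
    ... | yes refl = ≤-reflexive (trans (cong (_* G b b) (sym (≤∧≮⇒≡ (θ-nonNeg b) θb≯0)))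
                                        (*-zeroˡ (G b b)))
    ... | no  a′≢b = i*j≤0 (θ-nonNeg a′) (simple-obtuse a′≢b)

  -- Otherwise the roots supported on supp θ and those that are not would split Φ.
  θ-positive : ∀ j → 0ℤ < lookup θ j
  θ-positive j with 0ℤ <? lookup θ j
  ... | yes 0<θⱼ = 0<θⱼ
  ... | no  θⱼ≯0 = ⊥-elim (irr ( does ∘ supp?
                               , (θ , θ∈Φ , dec-true (supp? θ) θ⊆P)
                               , (e j , simple∈ j , dec-false (supp? (e j)) αⱼ⊈P)
                               , orthogonal ))
    where
    P : Fin n → Set
    P a = 0ℤ < lookup θ a
    P? : Decidable P
    P? a = 0ℤ <? lookup θ a
    supp? : ∀ v → Dec (SupportedIn P v)
    supp? = SupportedIn? P?
    θ⊆P : SupportedIn P θ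
    θ⊆P a θₐ≯0 = sym (≤∧≮⇒≡ (θ-nonNeg a) θₐ≯0)
    αⱼ⊈P : ¬ SupportedIn P (e j)
    αⱼ⊈P αⱼ⊆P with trans (sym (lookup-e-≡ j)) (αⱼ⊆P j θⱼ≯0)
    ... | ()
    orthogonal : ∀ α β → α ∈ Φ → β ∈ Φ → does (supp? α) ≡ true → does (supp? β) ≡ false →
                 form G α β ≡ 0ℤ
    orthogonal α β _ β∈Φ α⊆P β⊈P =
      form-separated {u = α} {β} P? θ-separates (invert (subst (Reflects _) α⊆P (proof (supp? α))))
        ([ (λ β⊆P → ⊥-elim (invert (subst (Reflects _) β⊈P (proof (supp? β))) β⊆P)) , id ]′
          (root-in-component P? θ-separates β∈Φ))

  θ-above-dominant : ∀ {μ} → μ ∈ Φ → Nonneg μ → Dominant μ → θ ≥ʳ μ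
  θ-above-dominant {μ} μ∈Φ 0≤μ μ-dominant
    with comparable θ∈Φ μ∈Φ (0<form-dominant {θ} θ-positive μ∈Φ 0≤μ μ-dominant)
  ... | inj₁ θ≥μ = θ≥μ
  ... | inj₂ μ≥θ = subst (θ ≥ʳ_) (sym (≥ʳ-ht-antisym {u = μ} {θ} μ≥θ (θ-maximal μ∈Φ 0≤μ))) (≥ʳ-refl θ)

  θ-highest : ∀ γ → γ ∈ Φ → θ ≥ʳ γ
  θ-highest γ γ∈Φ with base γ γ∈Φ
  ... | inj₂ γ≤0 = ≤⇒≥ʳ {u = θ} {γ} (λ a → ≤-trans (γ≤0 a) (θ-nonNeg a))
  ... | inj₁ 0≤γ =
    let μ , (μ∈Φ , μ≥γ) , μ-maximal = maximal-element ht (λ y → Nonneg? (y ⊖ γ)) Φ γ∈Φ (≥ʳ-refl γ)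
        0≤μ , μ-dominant = maximal-above-dominant 0≤γ μ∈Φ μ≥γ μ-maximal
    in ≥ʳ-trans {u = θ} {μ} {γ} (θ-above-dominant μ∈Φ 0≤μ μ-dominant) μ≥γ

module CominusculeRoots {n : ℕ} (R : RootSystem n) (irr : Irreducible R)
                        (i : Fin n) (cm : Cominuscule R i) where
  open RootSystem R
  open Roots R
  open HighestRoot R irr i

  coordinate≤1 : ∀ {γ} → γ ∈ Φ → lookup γ i ≤ 1ℤ
  coordinate≤1 {γ} γ∈Φ =
    subst (lookup γ i ≤_) (cm θ (θ∈Φ , θ-highest)) (≥ʳ⇒≤ {u = θ} {γ} (θ-highest γ γ∈Φ) i)

  -1≤coordinate : ∀ {γ} → γ ∈ Φ → - 1ℤ ≤ lookup γ i
  -1≤coordinate {γ} γ∈Φ = subst (- 1ℤ ≤_) (neg-involutive (lookup γ i))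
    (neg-mono-≤ (subst (_≤ 1ℤ) (lookup-neg γ i) (coordinate≤1 (neg∈Φ γ∈Φ))))

  Φ⁽ⁱ⁾-coordinate : ∀ {α} → Φ⁽_⁾ R i α → lookup α i ≡ 1ℤ
  Φ⁽ⁱ⁾-coordinate {α} ((α∈Φ , _) , α≥αᵢ) = ≤-antisym (coordinate≤1 α∈Φ)
    (subst (_≤ lookup α i) (lookup-e-≡ i) (≥ʳ⇒≤ {u = α} {e i} α≥αᵢ i))

  module Reflection {α β} (α⁽ⁱ⁾ : Φ⁽_⁾ R i α) (β⁽ⁱ⁾ : Φ⁽_⁾ R i β) {c} (αβ≡c : Pairing G α β c) where

    α∈Φ : α ∈ Φ
    α∈Φ = proj₁ (proj₁ α⁽ⁱ⁾)

    β∈Φ : β ∈ Φ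
    β∈Φ = proj₁ (proj₁ β⁽ⁱ⁾)

    s : Vec ℤ n
    s = β ⊕ ((- c) · α)

    lookup-s : ∀ a → lookup s a ≡ lookup β a - c * lookup α a
    lookup-s a = trans (lookup-⊕ β ((- c) · α) a)
      (trans (cong (_+_ (lookup β a)) (lookup-· (- c) α a))
             (cong (_+_ (lookup β a)) (sym (neg-distribˡ-* c (lookup α a)))))

    s∈Φ : s ∈ Φ
    s∈Φ = subst (_∈ Φ) (lookup-ext λ a → trans (lookup-⊖· c β α a) (sym (lookup-s a)))
            (reflect α β c α∈Φ β∈Φ αβ≡c)

    sᵢ≡1-c : lookup s i ≡ 1ℤ - c
    sᵢ≡1-c = trans (lookup-s i)
      (trans (cong₂ (λ b a → b - c * a) (Φ⁽ⁱ⁾-coordinate β⁽ⁱ⁾) (Φ⁽ⁱ⁾-coordinate α⁽ⁱ⁾))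
             (cong (_-_ 1ℤ) (*-identityʳ c)))

    c∈[0,2] : c ≡ 0ℤ ⊎ c ≡ 1ℤ ⊎ c ≡ + 2
    c∈[0,2] = -1≤1-c≤1⇒c∈[0,2] c (subst (- 1ℤ ≤_) sᵢ≡1-c (-1≤coordinate s∈Φ))
                                 (subst (_≤ 1ℤ) sᵢ≡1-c (coordinate≤1 s∈Φ))

    c≡0⇒s≡β : c ≡ 0ℤ → s ≡ β
    c≡0⇒s≡β c≡0 = lookup-ext λ a → trans (lookup-s a)
      (trans (cong (λ x → lookup β a - x * lookup α a) c≡0) (+-identityʳ (lookup β a)))

    0<⟨α,β⟩ : c ≢ 0ℤ → 0ℤ < form G α β
    0<⟨α,β⟩ c≢0 = 0<i*j⇒0<j {+ 2} (+≤+ z≤n)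
      (subst (0ℤ <_) (trans (sym αβ≡c) (x+x≡2*x (form G α β))) (0<i*j 0<c (0<form-root α∈Φ)))
      where
      0<c : 0ℤ < c
      0<c with c∈[0,2]
      ... | inj₁ c≡0         = contradiction c≡0 c≢0
      ... | inj₂ (inj₁ refl) = +<+ (s≤s z≤n)
      ... | inj₂ (inj₂ refl) = +<+ (s≤s z≤n)

    incomparable⇒s≡β : ¬ (α ≥ʳ β) → ¬ (β ≥ʳ α) → s ≡ β
    incomparable⇒s≡β α≱β β≱α with c ≟ 0ℤ
    ... | yes c≡0 = c≡0⇒s≡β c≡0
    ... | no  c≢0 = ⊥-elim ([ α≱β , β≱α ]′ (comparable α∈Φ β∈Φ (0<⟨α,β⟩ c≢0)))

    lookup-neg-s : ∀ a → lookup (neg s) a ≡ c * lookup α a - lookup β a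
    lookup-neg-s a =
      trans (lookup-neg s a) (trans (cong -_ (lookup-s a)) (-[y-x]≡x-y (lookup β a) (c * lookup α a)))
      where
      -[y-x]≡x-y : ∀ y x → - (y - x) ≡ x - y
      -[y-x]≡x-y = solve-∀

    s≡-[-s] : s ≡ neg (neg s)
    s≡-[-s] = sym (neg-involutiveᵛ s)

    c≡1⇒-s≡α-β : c ≡ 1ℤ → neg s ≡ α ⊖ β
    c≡1⇒-s≡α-β c≡1 = lookup-ext λ a → trans (lookup-neg-s a)
      (trans (cong (λ x → x * lookup α a - lookup β a) c≡1)
             (trans (cong (_- lookup β a) (*-identityˡ (lookup α a))) (sym (lookup-⊖ α β a))))

    c≡2⇒α-β≡-s-α : c ≡ + 2 → α ⊖ β ≡ neg s ⊖ α
    c≡2⇒α-β≡-s-α c≡2 = lookup-ext λ a → begin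
        lookup (α ⊖ β) a
      ≡⟨ lookup-⊖ α β a ⟩
        lookup α a - lookup β a
      ≡⟨ regroup (lookup α a) (lookup β a) ⟩
        + 2 * lookup α a - lookup β a - lookup α a
      ≡⟨ cong (λ x → x * lookup α a - lookup β a - lookup α a) c≡2 ⟨
        c * lookup α a - lookup β a - lookup α a
      ≡⟨ cong (_- lookup α a) (lookup-neg-s a) ⟨
        lookup (neg s) a - lookup α a
      ≡⟨ lookup-⊖ (neg s) α a ⟨
        lookup (neg s ⊖ α) a
      ∎
      where
      open ≡-Reasoning
      regroup : ∀ x y → x - y ≡ + 2 * x - y - x
      regroup = solve-∀

    s-when-α>β : α >ʳ β → s ≡ β
                          ⊎ (∃ λ γ → Pos R γ × ¬ Φ⁽_⁾ R i γ × s ≡ neg γ)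
                          ⊎ (∃ λ γ → γ ∈ Φ × γ >ʳ α × s ≡ neg γ)
    s-when-α>β (α≥β , α≢β) with c∈[0,2]
    ... | inj₁ c≡0 = inj₁ (c≡0⇒s≡β c≡0)
    ... | inj₂ (inj₁ c≡1) =
      inj₂ (inj₁ (neg s , (neg∈Φ s∈Φ , subst Nonneg (sym -s≡α-β) α≥β) , -s∉Φ⁽ⁱ⁾ , s≡-[-s]))
      where
      -s≡α-β = c≡1⇒-s≡α-β c≡1
      -s∉Φ⁽ⁱ⁾ : ¬ Φ⁽_⁾ R i (neg s)
      -s∉Φ⁽ⁱ⁾ -s⁽ⁱ⁾ with trans (sym (Φ⁽ⁱ⁾-coordinate -s⁽ⁱ⁾))
                           (trans (cong (λ v → lookup v i) -s≡α-β)
                             (trans (lookup-⊖ α β i) (cong₂ _-_ (Φ⁽ⁱ⁾-coordinate α⁽ⁱ⁾) (Φ⁽ⁱ⁾-coordinate β⁽ⁱ⁾))))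
      ... | ()
    ... | inj₂ (inj₂ c≡2) =
      inj₂ (inj₂ (neg s , neg∈Φ s∈Φ , (subst Nonneg α-β≡-s-α α≥β , -s≢α) , s≡-[-s]))
      where
      α-β≡-s-α = c≡2⇒α-β≡-s-α c≡2
      -s≢α : neg s ≢ α
      -s≢α -s≡α = α≢β (⊖≡0⃗⇒≡ (trans α-β≡-s-α (trans (cong (_⊖ α) -s≡α) (⊖-self α))))

lemma6p3 : (n : ℕ) (R : RootSystem n) → Irreducible R →
    (i : Fin n) → Cominuscule R i →
    (α β : Vec ℤ n) → Φ⁽_⁾ R i α → Φ⁽_⁾ R i β →
    (c : ℤ) → Pairing (RootSystem.G R) α β c →
    let k = - c
        s = β ⊕ (k · α)
    in (k ≡ 0ℤ ⊎ k ≡ - 1ℤ ⊎ k ≡ - (1ℤ + 1ℤ))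
       × ((¬ (α ≥ʳ β) → ¬ (β ≥ʳ α) → s ≡ β)
       × (α >ʳ β →
            s ≡ β
            ⊎ (∃ λ γ → Pos R γ × ¬ Φ⁽_⁾ R i γ × s ≡ neg γ)
            ⊎ (∃ λ γ → γ ∈ RootSystem.Φ R × γ >ʳ α × s ≡ neg γ)))
lemma6p3 n R irr i cm α β α⁽ⁱ⁾ β⁽ⁱ⁾ c αβ≡c =
  ⊎-map -‿cong (⊎-map -‿cong -‿cong) c∈[0,2] , incomparable⇒s≡β , s-when-α>β
  where
  open CominusculeRoots R irr i cm
  open Reflection α⁽ⁱ⁾ β⁽ⁱ⁾ {c} αβ≡c
  -‿cong : ∀ {x y} → x ≡ y → - x ≡ - y
  -‿cong = cong (λ x → - x)
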